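{- Let $$A_0=\begin{pmatrix}1&0&1\\0&1&1\\0&0&1\end{pmatrix},\quad A_1=\begin{pmatrix}0&0&1\\1&0&1\\0&1&1\end{pmatrix},\quad A_2=\begin{pmatrix}0&1&1\\0&0&1\\1&0&1\end{pmatrix},\quad V=\begin{pmatrix}0&1&1\\0&0&1\\1&1&1\end{pmatrix}.$$ For every $n\ge 0$ and every tuple $I=(i_1,\dots,i_n)$ with each $i_j\in\{0,1,2\}$, the third (bottom) row of the matrix $VA_{i_1}\cdots A_{i_n}$ is $(v_1(I),v_2(I),v_3(I))$.
   Context: For a tuple $I=(i_1,\dots,i_n)$ with each $i_j\in\{0,1,2\}$, the numbers $v_1(I),v_2(I),v_3(I)$ (the entries of Stern's triatomic sequence at level $n$ indexed by $I$) are defined recursively by $(v_1(\emptyset),v_2(\emptyset),v_3(\emptyset))=(1,1,1)$ and, writing $s=v_1(I)+v_2(I)+v_3(I)$: $(v_1,v_2,v_3)(I,0)=(v_1(I),v_2(I),s)$, $(v_1,v_2,v_3)(I,1)=(v_2(I),v_3(I),s)$, $(v_1,v_2,v_3)(I,2)=(v_3(I),v_1(I),s)$. -}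

module Defs where

open import Data.Nat using (ℕ; _+_; _*_)
open import Data.Fin using (Fin; zero; suc)
open import Data.List using (List; []; _∷_; foldl)
open import Data.Product using (_×_; _,_)

-- 3×3 matrices over ℕ as functions; entry M i j = row i, column j (0-based)
Mat3 : Set
Mat3 = Fin 3 → Fin 3 → ℕ

_⊗_ : Mat3 → Mat3 → Mat3
(M ⊗ N) i j = M i zero * N zero j + (M i (suc zero) * N (suc zero) j + M i (suc (suc zero)) * N (suc (suc zero)) j)

mat : ℕ → ℕ → ℕ → ℕ → ℕ → ℕ → ℕ → ℕ → ℕ → Mat3
mat a b c d e f g h k zero zero = a
mat a b c d e f g h k zero (suc zero) = b
mat a b c d e f g h k zero (suc (suc zero)) = c
mat a b c d e f g h k (suc zero) zero = d
mat a b c d e f g h k (suc zero) (suc zero) = e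
mat a b c d e f g h k (suc zero) (suc (suc zero)) = f
mat a b c d e f g h k (suc (suc zero)) zero = g
mat a b c d e f g h k (suc (suc zero)) (suc zero) = h
mat a b c d e f g h k (suc (suc zero)) (suc (suc zero)) = k

A : Fin 3 → Mat3
A zero = mat 1 0 1  0 1 1  0 0 1
A (suc zero) = mat 0 0 1  1 0 1  0 1 1
A (suc (suc zero)) = mat 0 1 1  0 0 1  1 0 1

V : Mat3
V = mat 0 1 1  0 0 1  1 1 1

prodVA : List (Fin 3) → Mat3
prodVA I = foldl (λ M i → M ⊗ A i) V I

-- Stern's triatomic triple: one step (I ↦ (I,i))
step : ℕ × ℕ × ℕ → Fin 3 → ℕ × ℕ × ℕ
step (a , b , c) zero = (a , b , a + b + c)
step (a , b , c) (suc zero) = (b , c , a + b + c)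
step (a , b , c) (suc (suc zero)) = (c , a , a + b + c)

triple : List (Fin 3) → ℕ × ℕ × ℕ
triple I = foldl step (1 , 1 , 1) I

bottomRow : Mat3 → ℕ × ℕ × ℕ
bottomRow M = (M (suc (suc zero)) zero , M (suc (suc zero)) (suc zero) , M (suc (suc zero)) (suc (suc zero)))

-- The bottom row of M N is the bottom row of M times N, and the row vector
-- (a, b, c) times A_i is exactly one step of the triatomic recursion applied to
-- (a, b, c). As V has bottom row (1, 1, 1), the bottom row of V A_{i_1} ⋯ A_{i_n}
-- therefore follows the recursion along I.
module Submission where

open import Defs
open import Data.Fin using (Fin; zero; suc)
open import Data.List using (List; []; _∷_; foldl)
open import Data.Nat using (ℕ; _+_; _*_)
open import Data.Nat.Tactic.RingSolver using (solve-∀)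
open import Data.Product using (_×_; _,_)
open import Relation.Binary.PropositionalEquality using (_≡_; refl; cong; cong₂; trans)

foldl-fusion : ∀ {a b c} {A : Set a} {B : Set b} {C : Set c}
               (h : A → B) {f : A → C → A} {g : B → C → B} →
               (∀ x y → h (f x y) ≡ g (h x) y) →
               ∀ x ys → h (foldl f x ys) ≡ foldl g (h x) ys
foldl-fusion h hom x []                 = refl
foldl-fusion h {f} {g} hom x (y ∷ ys) =
  trans (foldl-fusion h hom (f x y) ys) (cong (λ z → foldl g z ys) (hom x y))

Row3 : Set
Row3 = ℕ × ℕ × ℕ

_·_ : Row3 → Mat3 → Row3
(a , b , c) · N = column zero , column (suc zero) , column (suc (suc zero))
  where
  column : Fin 3 → ℕ
  column j = a * N zero j + (b * N (suc zero) j + c * N (suc (suc zero)) j)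

bottomRow-⊗ : ∀ M N → bottomRow (M ⊗ N) ≡ bottomRow M · N
bottomRow-⊗ M N = refl

x*1+y*0+z*0≡x : ∀ x y z → x * 1 + (y * 0 + z * 0) ≡ x
x*1+y*0+z*0≡x = solve-∀

x*0+y*1+z*0≡y : ∀ x y z → x * 0 + (y * 1 + z * 0) ≡ y
x*0+y*1+z*0≡y = solve-∀

x*0+y*0+z*1≡z : ∀ x y z → x * 0 + (y * 0 + z * 1) ≡ z
x*0+y*0+z*1≡z = solve-∀

x*1+y*1+z*1≡x+y+z : ∀ x y z → x * 1 + (y * 1 + z * 1) ≡ x + y + z
x*1+y*1+z*1≡x+y+z = solve-∀

·A≡step : ∀ r i → r · A i ≡ step r i
·A≡step (a , b , c) zero =
  cong₂ _,_ (x*1+y*0+z*0≡x a b c) (cong₂ _,_ (x*0+y*1+z*0≡y a b c) (x*1+y*1+z*1≡x+y+z a b c))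
·A≡step (a , b , c) (suc zero) =
  cong₂ _,_ (x*0+y*1+z*0≡y a b c) (cong₂ _,_ (x*0+y*0+z*1≡z a b c) (x*1+y*1+z*1≡x+y+z a b c))
·A≡step (a , b , c) (suc (suc zero)) =
  cong₂ _,_ (x*0+y*0+z*1≡z a b c) (cong₂ _,_ (x*1+y*0+z*0≡x a b c) (x*1+y*1+z*1≡x+y+z a b c))

bottomRow-⊗A : ∀ M i → bottomRow (M ⊗ A i) ≡ step (bottomRow M) i
bottomRow-⊗A M i = trans (bottomRow-⊗ M (A i)) (·A≡step (bottomRow M) i)

mainTheorem2 : (I : List (Fin 3)) → bottomRow (prodVA I) ≡ triple I
mainTheorem2 = foldl-fusion bottomRow bottomRow-⊗A V
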